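{- Let $C_n$ be the cycle on $n\ge 3$ vertices with $n\neq 4$, and let $d=\lfloor n/2\rfloor$ be its diameter. Let $\kappa(C_n,d)$ be the minimum of $|\lambda|$ over all labelings $\lambda$ such that $(C_n,\lambda)$ is temporally connected and has age at most $d$. Then $\kappa(C_n,d)=d^2$ if $n=2d$, and $\kappa(C_n,d)=2d^2+d$ if $n=2d+1$.
   Context: A temporal graph is a pair $(G,\lambda)$ where $G=(V,E)$ is an undirected graph and $\lambda: E\to 2^{\mathbb{N}}$ assigns to each edge a set of positive integer time-labels; $|\lambda|=\sum_{e\in E}|\lambda(e)|$ and the age is $\alpha(G,\lambda)=\max\{t: t\in\lambda(e), e\in E\}$. A (strict) temporal path is a sequence $(e_1,t_1),\dots,(e_k,t_k)$ where $(e_1,\dots,e_k)$ is a path in $G$, $t_i\in\lambda(e_i)$, and $t_1<\dots<t_k$. $(G,\lambda)$ is temporally connected if for every ordered pair of distinct vertices $u,v$ there is a temporal path from $u$ to $v$. -}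

module Defs where

open import Data.Nat using (ℕ; zero; suc; _+_; _*_; _≤_; _<_)
open import Data.Nat.DivMod using (_mod_)
open import Data.Fin using (Fin; toℕ)
open import Data.Bool using (Bool; true; false; if_then_else_)
open import Data.List using (List; []; _∷_; map; allFin)
open import Data.Nat.ListAction using (sum)
open import Data.List.Relation.Unary.Unique.Propositional using (Unique)
open import Data.Product using (Σ; _×_; _,_; ∃)
open import Data.Sum using (_⊎_)
open import Relation.Binary.PropositionalEquality using (_≡_)

record Graph : Set where
  field
    nV  : ℕ
    nE  : ℕ
    src : Fin nE → Fin nV
    tgt : Fin nE → Fin nV
open Graph public

Joins : (G : Graph) → Fin (nE G) → Fin (nV G) → Fin (nV G) → Set
Joins G e u w = (src G e ≡ u × tgt G e ≡ w) ⊎ (tgt G e ≡ u × src G e ≡ w)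

-- A labeling: λ e t ≡ true  means  t ∈ λ(e).
Labeling : Graph → Set
Labeling G = Fin (nE G) → ℕ → Bool

-- TWalk G λ u v b vs : a temporal walk from u to v, all of whose time labels
-- are strictly increasing and strictly greater than b; vs is the list of
-- vertices visited (including u and v).
data TWalk (G : Graph) (λ' : Labeling G) :
       Fin (nV G) → Fin (nV G) → ℕ → List (Fin (nV G)) → Set where
  stop : ∀ {u b} → TWalk G λ' u u b (u ∷ [])
  step : ∀ {u w v b vs} (e : Fin (nE G)) (t : ℕ) →
         λ' e t ≡ true → b < t → Joins G e u w →
         TWalk G λ' w v t vs → TWalk G λ' u v b (u ∷ vs)

-- A strict temporal path from u to v: a temporal walk (labels positive, i.e. > 0)
-- whose vertices are pairwise distinct (so the underlying edges form a path in G).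
TemporalPath : (G : Graph) → Labeling G → Fin (nV G) → Fin (nV G) → Set
TemporalPath G λ' u v = ∃ λ vs → TWalk G λ' u v 0 vs × Unique vs

TemporallyConnected : (G : Graph) → Labeling G → Set
TemporallyConnected G λ' = ∀ u v → u ≡ v ⊎ TemporalPath G λ' u v

LabelsWithinAge : (G : Graph) → Labeling G → ℕ → Set
LabelsWithinAge G λ' a = ∀ e t → λ' e t ≡ true → 1 ≤ t × t ≤ a

countUpTo : (ℕ → Bool) → ℕ → ℕ
countUpTo f zero    = 0
countUpTo f (suc a) = (if f (suc a) then 1 else 0) + countUpTo f a

-- |λ| for a labeling whose labels lie in {1,…,a}
labelSize : (G : Graph) → Labeling G → ℕ → ℕ
labelSize G λ' a = sum (map (λ e → countUpTo (λ' e) a) (allFin (nE G)))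

KappaIs : Graph → ℕ → ℕ → Set
KappaIs G a k =
  (Σ (Labeling G) λ λ' → LabelsWithinAge G λ' a × TemporallyConnected G λ'
                         × labelSize G λ' a ≡ k)
  × (∀ (λ' : Labeling G) → LabelsWithinAge G λ' a → TemporallyConnected G λ'
       → k ≤ labelSize G λ' a)

cycleNext : ∀ {n} → Fin n → Fin n
cycleNext {suc k} i = suc (toℕ i) mod (suc k)

Cycle : ℕ → Graph
Cycle n = record { nV = n ; nE = n ; src = λ i → i ; tgt = cycleNext }

-- If the age is d = ⌊n/2⌋, a temporal path from u to the antipodal vertex u ⊕ d has at most
-- d steps, so it runs straight around one side of the cycle with the labels 1, …, d in this
-- order; for odd n only the clockwise side is short enough. Hence at every time j ≤ d each
-- vertex u forces label j on the j-th edge clockwise from u, or (n even) on the j-th edge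
-- counterclockwise from u. Every edge is the j-th edge from exactly one vertex in each
-- direction, so each time carries at least n labels when n is odd and n/2 = d labels when n
-- is even. Both bounds are attained: for odd n give every edge the labels 1, …, d; for even n
-- give edge e the labels t ≤ d with e + t odd, so that from every vertex one direction is
-- labelled 1, 2, …, d and the other 2, …, d.

module Submission where

open import Defs
open import Data.Nat using (ℕ; _+_; _*_; _≤_; ⌊_/2⌋)
open import Data.Product using (_×_)
open import Relation.Binary.PropositionalEquality using (_≡_; _≢_)

open import Data.Nat using (NonZero; zero; suc; z<s; _<_; _∸_; z≤n; s≤s; _%_; _≤?_; _<?_; parity)
open import Data.Nat.Properties
open import Data.Nat.DivMod using (_/_; %-distribˡ-+; m%n%n≡m%n; n%n≡0; m≡m%n+[m/n]*n; m<n⇒m%n≡m; [m+n]%n≡m%n)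
open import Data.Nat.Tactic.RingSolver using (solve-∀)
open import Data.Parity.Base as ℙ using (0ℙ; 1ℙ)
open import Data.Parity.Properties as ℙₚ using (+-homo-+; *-homo-*)
open import Data.Fin as Fin using (Fin; toℕ; fromℕ; inject₁)
open import Data.Fin.Relation.Unary.Top using (view; ‵fromℕ; ‵inject₁)
open import Data.Fin.Properties using (toℕ-injective; toℕ-fromℕ; toℕ-fromℕ<; toℕ-inject₁; toℕ<n)
import Data.Fin.Permutation as Perm
open import Data.Bool using (Bool; true; if_then_else_; _∧_)
open import Function using (id; _∘_)
open import Data.Empty using (⊥-elim)
open import Data.Product using (∃; _,_; proj₁; proj₂; uncurry)
open import Data.Sum using (_⊎_; inj₁; inj₂)
open import Data.List using (map; tabulate; applyUpTo)
import Data.Nat.ListAction as List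
open import Data.List.Relation.Unary.Unique.Propositional.Properties using (applyUpTo⁺₁)
open import Relation.Nullary using (Dec; yes; no; does)
open import Relation.Nullary.Decidable using (dec-true; _×-dec_)
open import Relation.Binary.Definitions using (tri<; tri≈; tri>)
open import Relation.Binary.PropositionalEquality using (refl; sym; trans; cong; cong₂; subst; subst₂; module ≡-Reasoning)
open import Algebra.Properties.CommutativeMonoid.Sum +-0-commutativeMonoid
  using (sum; sum-syntax; sum-cong-≗; ∑-distrib-+; ∑-permute)

open ≡-Reasoning

m+m≤n+n⇒m≤n : ∀ {m n} → m + m ≤ n + n → m ≤ n
m+m≤n+n⇒m≤n m+m≤n+n = ≮⇒≥ (λ n<m → <⇒≱ (+-mono-< n<m n<m) m+m≤n+n)

[m%n+o]%n≡[m+o]%n : ∀ m o n .{{_ : NonZero n}} → (m % n + o) % n ≡ (m + o) % n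
[m%n+o]%n≡[m+o]%n m o n = begin
  (m % n + o) % n         ≡⟨ %-distribˡ-+ (m % n) o n ⟩
  (m % n % n + o % n) % n ≡⟨ cong (λ r → (r + o % n) % n) (m%n%n≡m%n m n) ⟩
  (m % n + o % n) % n     ≡⟨ %-distribˡ-+ m o n ⟨
  (m + o) % n             ∎

m<n∧k+n≤o⇒1+k+m≤o : ∀ {m n o} k → m < n → k + n ≤ o → suc k + m ≤ o
m<n∧k+n≤o⇒1+k+m≤o {m} {n} k m<n k+n≤o = ≤-trans (subst (_≤ k + n) (+-suc k m) (+-monoʳ-≤ k m<n)) k+n≤o

m<n∧k+n≤o∧1+k+m≡o⇒n≡1+m : ∀ {m n o} k → m < n → k + n ≤ o → suc k + m ≡ o → n ≡ suc m
m<n∧k+n≤o∧1+k+m≡o⇒n≡1+m {m} {n} k m<n k+n≤o 1+k+m≡o = ≤-antisym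
  (+-cancelˡ-≤ k n (suc m) (subst (k + n ≤_) (trans (sym 1+k+m≡o) (sym (+-suc k m))) k+n≤o)) m<n

m<n∧k+n≤o⇒k+m≢o : ∀ {m n o} k → m < n → k + n ≤ o → k + m ≢ o
m<n∧k+n≤o⇒k+m≢o k m<n k+n≤o k+m≡o = <-irrefl k+m≡o (<-≤-trans (+-monoʳ-< k m<n) k+n≤o)

parity-% : ∀ m N .{{_ : NonZero N}} → parity N ≡ 0ℙ → parity (m % N) ≡ parity m
parity-% m N pN = sym (begin
  parity m                                         ≡⟨ cong parity (m≡m%n+[m/n]*n m N) ⟩
  parity (m % N + m / N * N)                       ≡⟨ +-homo-+ (m % N) (m / N * N) ⟩
  parity (m % N) ℙ.+ parity (m / N * N)            ≡⟨ cong (parity (m % N) ℙ.+_) (*-homo-* (m / N) N) ⟩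
  parity (m % N) ℙ.+ (parity (m / N) ℙ.* parity N) ≡⟨ cong (λ p → parity (m % N) ℙ.+ (parity (m / N) ℙ.* p)) pN ⟩
  parity (m % N) ℙ.+ (parity (m / N) ℙ.* 0ℙ)       ≡⟨ cong (parity (m % N) ℙ.+_) (ℙₚ.*-zeroʳ (parity (m / N))) ⟩
  parity (m % N) ℙ.+ 0ℙ                            ≡⟨ ℙₚ.+-identityʳ (parity (m % N)) ⟩
  parity (m % N)                                   ∎)

[p+q]+[q+r]≡p+r : ∀ p q r → (p ℙ.+ q) ℙ.+ (q ℙ.+ r) ≡ p ℙ.+ r
[p+q]+[q+r]≡p+r 0ℙ 0ℙ r  = refl
[p+q]+[q+r]≡p+r 0ℙ 1ℙ 0ℙ = refl
[p+q]+[q+r]≡p+r 0ℙ 1ℙ 1ℙ = refl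
[p+q]+[q+r]≡p+r 1ℙ 0ℙ r  = refl
[p+q]+[q+r]≡p+r 1ℙ 1ℙ 0ℙ = refl
[p+q]+[q+r]≡p+r 1ℙ 1ℙ 1ℙ = refl

p+q+q≡p : ∀ p q → (p ℙ.+ q) ℙ.+ q ≡ p
p+q+q≡p p q = trans (ℙₚ.+-assoc p q q) (trans (cong (p ℙ.+_) (ℙₚ.p+p≡0ℙ q)) (ℙₚ.+-identityʳ p))

indicator : Bool → ℕ
indicator b = if b then 1 else 0

1≤indicator : ∀ {b} → b ≡ true → 1 ≤ indicator b
1≤indicator refl = ≤-refl

isOdd : ℕ → Bool
isOdd m = does (parity m ℙₚ.≟ 1ℙ)

isOdd-consecutive : ∀ o → indicator (isOdd o) + indicator (isOdd (suc o)) ≡ 1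
isOdd-consecutive zero          = refl
isOdd-consecutive (suc zero)    = refl
isOdd-consecutive (suc (suc o)) = isOdd-consecutive o

∑-const : ∀ m c → ∑[ i < m ] c ≡ m * c
∑-const zero    c = refl
∑-const (suc m) c = cong (c +_) (∑-const m c)

∑-mono-≤ : ∀ {m} {f g : Fin m → ℕ} → (∀ i → f i ≤ g i) → sum f ≤ sum g
∑-mono-≤ {zero}  f≤g = z≤n
∑-mono-≤ {suc m} f≤g = +-mono-≤ (f≤g Fin.zero) (∑-mono-≤ (λ i → f≤g (Fin.suc i)))

∑-positive : ∀ {m} {f : Fin m → ℕ} → (∀ i → 1 ≤ f i) → m ≤ sum f
∑-positive {m} {f} pos = subst (_≤ sum f) (trans (∑-const m 1) (*-identityʳ m)) (∑-mono-≤ {g = f} pos)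

sum-map-tabulate : ∀ {A : Set} {m} (h : A → ℕ) (g : Fin m → A) →
                   List.sum (map h (tabulate g)) ≡ ∑[ i < m ] h (g i)
sum-map-tabulate {m = zero}  h g = refl
sum-map-tabulate {m = suc m} h g = cong (h (g Fin.zero) +_) (sum-map-tabulate h (λ i → g (Fin.suc i)))

∑-isOdd : ∀ m o → ∑[ i < m + m ] indicator (isOdd (toℕ i + o)) ≡ m
∑-isOdd zero    o = refl
∑-isOdd (suc m) o = subst (λ N → ∑[ i < N ] indicator (isOdd (toℕ i + o)) ≡ suc m) (cong suc (sym (+-suc m m)))
  (trans (sym (+-assoc (indicator (isOdd o)) (indicator (isOdd (suc o))) _))
         (cong₂ _+_ (isOdd-consecutive o) (∑-isOdd m o)))

fromDoes : ∀ {A : Set} (a? : Dec A) → does a? ≡ true → A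
fromDoes (yes a) _  = a
fromDoes (no _)  ()

InWindow : ℕ → ℕ → Set
InWindow d t = 1 ≤ t × t ≤ d

window? : ∀ d t → Dec (InWindow d t)
window? d t = 1 ≤? t ×-dec t ≤? d

window?-true : ∀ {d j} → j < d → does (window? d (suc j)) ≡ true
window?-true {d} {j} j<d = dec-true (window? d (suc j)) (s≤s z≤n , j<d)

inWindow : ∀ {d s c j} → c + s ≤ d → j < c → InWindow d (suc (j + s))
inWindow {s = s} c+s≤d j<c = s≤s z≤n , ≤-trans (+-monoˡ-≤ s j<c) c+s≤d

module _ (G : Graph) where

  labelSize-∑ : ∀ λ' a → labelSize G λ' a ≡ ∑[ e < nE G ] countUpTo (λ' e) a
  labelSize-∑ λ' a = sum-map-tabulate (λ e → countUpTo (λ' e) a) id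

  edgesLabelled : Labeling G → ℕ → ℕ
  edgesLabelled λ' t = ∑[ e < nE G ] indicator (λ' e t)

  labelSize-zero : ∀ λ' → labelSize G λ' 0 ≡ 0
  labelSize-zero λ' = trans (labelSize-∑ λ' 0) (trans (∑-const (nE G) 0) (*-zeroʳ (nE G)))

  labelSize-suc : ∀ λ' a → labelSize G λ' (suc a) ≡ edgesLabelled λ' (suc a) + labelSize G λ' a
  labelSize-suc λ' a = begin
    labelSize G λ' (suc a)
      ≡⟨ labelSize-∑ λ' (suc a) ⟩
    ∑[ e < nE G ] (indicator (λ' e (suc a)) + countUpTo (λ' e) a)
      ≡⟨ ∑-distrib-+ (λ e → indicator (λ' e (suc a))) (λ e → countUpTo (λ' e) a) ⟩
    edgesLabelled λ' (suc a) + ∑[ e < nE G ] countUpTo (λ' e) a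
      ≡⟨ cong (edgesLabelled λ' (suc a) +_) (sym (labelSize-∑ λ' a)) ⟩
    edgesLabelled λ' (suc a) + labelSize G λ' a ∎

  labelSize-≥ : ∀ λ' a K → (∀ j → j < a → K ≤ edgesLabelled λ' (suc j)) → a * K ≤ labelSize G λ' a
  labelSize-≥ λ' zero    K _     = z≤n
  labelSize-≥ λ' (suc a) K slots = subst (suc a * K ≤_) (sym (labelSize-suc λ' a))
    (+-mono-≤ (slots a ≤-refl) (labelSize-≥ λ' a K (λ j j<a → slots j (m<n⇒m<1+n j<a))))

  labelSize-≡ : ∀ λ' a K → (∀ j → j < a → edgesLabelled λ' (suc j) ≡ K) → labelSize G λ' a ≡ a * K
  labelSize-≡ λ' zero    K _     = labelSize-zero λ'
  labelSize-≡ λ' (suc a) K slots = trans (labelSize-suc λ' a)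
    (cong₂ _+_ (slots a ≤-refl) (labelSize-≡ λ' a K (λ j j<a → slots j (m<n⇒m<1+n j<a))))

  record ConsecutivelyLabelled (λ' : Labeling G) (es : ℕ → Fin (nE G)) (b m : ℕ) : Set where
    constructor consecutive
    field
      labelled : ∀ j → j < m → λ' (es j) (suc (j + b)) ≡ true
  open ConsecutivelyLabelled public

  module _ {λ' : Labeling G} {es : ℕ → Fin (nE G)} {b : ℕ} where

    consecutive-∷ : ∀ {m} → λ' (es 0) (suc b) ≡ true →
                    ConsecutivelyLabelled λ' (es ∘ suc) (suc b) m →
                    ConsecutivelyLabelled λ' es b (suc m)
    consecutive-∷ first rest = consecutive λ where
      zero    _         → first
      (suc j) (s≤s j<m) → subst (λ t → λ' (es (suc j)) t ≡ true) (cong suc (+-suc j b)) (labelled rest j j<m)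

    consecutive-tail : ∀ {m} → ConsecutivelyLabelled λ' es b (suc m) →
                       ConsecutivelyLabelled λ' (es ∘ suc) (suc b) m
    consecutive-tail run = consecutive λ j j<m →
      subst (λ t → λ' (es (suc j)) t ≡ true) (cong suc (sym (+-suc j b))) (labelled run (suc j) (s≤s j<m))

    consecutive-≤ : ∀ {m m′} → m′ ≤ m → ConsecutivelyLabelled λ' es b m →
                    ConsecutivelyLabelled λ' es b m′
    consecutive-≤ m′≤m run = consecutive λ j j<m′ → labelled run j (<-≤-trans j<m′ m′≤m)

  labelled₀ : ∀ {λ' es m} → ConsecutivelyLabelled λ' es 0 m → ∀ j → j < m → λ' (es j) (suc j) ≡ true
  labelled₀ {λ'} {es} run j j<m = subst (λ τ → λ' (es j) (suc τ) ≡ true) (+-identityʳ j) (labelled run j j<m)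

module OnCycle (k : ℕ) where

  n : ℕ
  n = suc k

  next : Fin n → Fin n
  next = cycleNext

  prev : Fin n → Fin n
  prev Fin.zero    = fromℕ k
  prev (Fin.suc i) = inject₁ i

  toℕ-next : ∀ u → toℕ (next u) ≡ suc (toℕ u) % n
  toℕ-next u = toℕ-fromℕ< _

  next-inject₁ : ∀ i → next (inject₁ i) ≡ Fin.suc i
  next-inject₁ i = toℕ-injective (begin
    toℕ (next (inject₁ i))    ≡⟨ toℕ-next (inject₁ i) ⟩
    suc (toℕ (inject₁ i)) % n ≡⟨ cong (λ r → suc r % n) (toℕ-inject₁ i) ⟩
    suc (toℕ i) % n           ≡⟨ m<n⇒m%n≡m (s≤s (toℕ<n i)) ⟩
    suc (toℕ i)               ∎)

  next-fromℕ : next (fromℕ k) ≡ Fin.zero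
  next-fromℕ = toℕ-injective (begin
    toℕ (next (fromℕ k))    ≡⟨ toℕ-next (fromℕ k) ⟩
    suc (toℕ (fromℕ k)) % n ≡⟨ cong (λ r → suc r % n) (toℕ-fromℕ k) ⟩
    n % n                   ≡⟨ n%n≡0 n ⟩
    0                       ∎)

  next-prev : ∀ u → next (prev u) ≡ u
  next-prev Fin.zero    = next-fromℕ
  next-prev (Fin.suc i) = next-inject₁ i

  prev-next : ∀ u → prev (next u) ≡ u
  prev-next u with view u
  ... | ‵fromℕ     = cong prev next-fromℕ
  ... | ‵inject₁ i = cong prev (next-inject₁ i)

  infixl 6 _⊕_ _⊖_

  -- Recursing on the left keeps the tail of a run from u definitionally a run from next u.
  _⊕_ : Fin n → ℕ → Fin n
  u ⊕ zero  = u
  u ⊕ suc j = next u ⊕ j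

  _⊖_ : Fin n → ℕ → Fin n
  u ⊖ zero  = u
  u ⊖ suc j = prev u ⊖ j

  ⊕-suc : ∀ u j → u ⊕ suc j ≡ next (u ⊕ j)
  ⊕-suc u zero    = refl
  ⊕-suc u (suc j) = ⊕-suc (next u) j

  ⊖-suc : ∀ u j → u ⊖ suc j ≡ prev (u ⊖ j)
  ⊖-suc u zero    = refl
  ⊖-suc u (suc j) = ⊖-suc (prev u) j

  ⊕-+ : ∀ u i j → u ⊕ (i + j) ≡ u ⊕ i ⊕ j
  ⊕-+ u zero    j = refl
  ⊕-+ u (suc i) j = ⊕-+ (next u) i j

  ⊖-⊕ : ∀ u j → u ⊖ j ⊕ j ≡ u
  ⊖-⊕ u zero    = refl
  ⊖-⊕ u (suc j) = begin
    prev u ⊖ j ⊕ suc j     ≡⟨ ⊕-suc (prev u ⊖ j) j ⟩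
    next (prev u ⊖ j ⊕ j) ≡⟨ cong next (⊖-⊕ (prev u) j) ⟩
    next (prev u)         ≡⟨ next-prev u ⟩
    u                     ∎

  ⊕-⊖ : ∀ u j → u ⊕ j ⊖ j ≡ u
  ⊕-⊖ u zero    = refl
  ⊕-⊖ u (suc j) = begin
    next u ⊕ j ⊖ suc j     ≡⟨ ⊖-suc (next u ⊕ j) j ⟩
    prev (next u ⊕ j ⊖ j) ≡⟨ cong prev (⊕-⊖ (next u) j) ⟩
    prev (next u)         ≡⟨ prev-next u ⟩
    u                     ∎

  toℕ-⊕ : ∀ u j → toℕ (u ⊕ j) ≡ (toℕ u + j) % n
  toℕ-⊕ u zero    = sym (trans (cong (_% n) (+-identityʳ (toℕ u))) (m<n⇒m%n≡m (toℕ<n u)))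
  toℕ-⊕ u (suc j) = begin
    toℕ (next u ⊕ j)            ≡⟨ toℕ-⊕ (next u) j ⟩
    (toℕ (next u) + j) % n      ≡⟨ cong (λ r → (r + j) % n) (toℕ-next u) ⟩
    (suc (toℕ u) % n + j) % n   ≡⟨ [m%n+o]%n≡[m+o]%n (suc (toℕ u)) j n ⟩
    (suc (toℕ u) + j) % n       ≡⟨ cong (_% n) (+-suc (toℕ u) j) ⟨
    (toℕ u + suc j) % n         ∎

  ⊕-n : ∀ u → u ⊕ n ≡ u
  ⊕-n u = toℕ-injective (begin
    toℕ (u ⊕ n)      ≡⟨ toℕ-⊕ u n ⟩
    (toℕ u + n) % n  ≡⟨ [m+n]%n≡m%n (toℕ u) n ⟩
    toℕ u % n        ≡⟨ m<n⇒m%n≡m (toℕ<n u) ⟩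
    toℕ u            ∎)

  zero⊕toℕ : ∀ u → Fin.zero ⊕ toℕ u ≡ u
  zero⊕toℕ u = toℕ-injective (trans (toℕ-⊕ Fin.zero (toℕ u)) (m<n⇒m%n≡m (toℕ<n u)))

  ⊕-⊕-comm : ∀ u i j → u ⊕ i ⊕ j ≡ u ⊕ j ⊕ i
  ⊕-⊕-comm u i j = trans (sym (⊕-+ u i j)) (trans (cong (u ⊕_) (+-comm i j)) (⊕-+ u j i))

  ⊕-surjective : ∀ u v → ∃ λ c → c < n × u ⊕ c ≡ v
  ⊕-surjective u v = toℕ w , toℕ<n w , (begin
    u ⊕ toℕ w                       ≡⟨ cong (_⊕ toℕ w) (zero⊕toℕ u) ⟨
    Fin.zero ⊕ toℕ u ⊕ toℕ w        ≡⟨ ⊕-⊕-comm Fin.zero (toℕ u) (toℕ w) ⟩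
    Fin.zero ⊕ toℕ w ⊕ toℕ u        ≡⟨ cong (_⊕ toℕ u) (zero⊕toℕ w) ⟩
    w ⊕ toℕ u                       ≡⟨ ⊖-⊕ v (toℕ u) ⟩
    v                               ∎)
    where
      w : Fin n
      w = v ⊖ toℕ u

  ⊕-fixpoint-free : ∀ u {δ} → 0 < δ → δ < n → u ⊕ δ ≢ u
  ⊕-fixpoint-free u {δ} 0<δ δ<n eq = notMultiple ((toℕ u + δ) / n) δ≡q*n
    where
      u⊕δ≡u : (toℕ u + δ) % n ≡ toℕ u
      u⊕δ≡u = trans (sym (toℕ-⊕ u δ)) (cong toℕ eq)
      δ≡q*n : δ ≡ (toℕ u + δ) / n * n
      δ≡q*n = +-cancelˡ-≡ (toℕ u) _ _ (begin
        toℕ u + δ                                 ≡⟨ m≡m%n+[m/n]*n (toℕ u + δ) n ⟩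
        (toℕ u + δ) % n + (toℕ u + δ) / n * n     ≡⟨ cong (_+ (toℕ u + δ) / n * n) u⊕δ≡u ⟩
        toℕ u + (toℕ u + δ) / n * n               ∎)
      notMultiple : ∀ q → δ ≢ q * n
      notMultiple zero    δ≡0 = <⇒≢ 0<δ (sym δ≡0)
      notMultiple (suc q) δ≡n+qn = <⇒≱ δ<n (subst (n ≤_) (sym δ≡n+qn) (m≤m+n n (q * n)))

  ⊕-distinct : ∀ u {i j} → i < j → j < n → u ⊕ i ≢ u ⊕ j
  ⊕-distinct u {i} {j} i<j j<n eq =
    ⊕-fixpoint-free (u ⊕ i) (m<n⇒0<n∸m i<j) (≤-<-trans (m∸n≤m j i) j<n) (begin
      u ⊕ i ⊕ (j ∸ i)    ≡⟨ ⊕-+ u i (j ∸ i) ⟨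
      u ⊕ (i + (j ∸ i))  ≡⟨ cong (u ⊕_) (m+[n∸m]≡n (<⇒≤ i<j)) ⟩
      u ⊕ j              ≡⟨ eq ⟨
      u ⊕ i              ∎)

  ⊕-injective : ∀ u {i j} → i < n → j < n → u ⊕ i ≡ u ⊕ j → i ≡ j
  ⊕-injective u {i} {j} i<n j<n eq with <-cmp i j
  ... | tri< i<j _ _ = ⊥-elim (⊕-distinct u i<j j<n eq)
  ... | tri≈ _ i≡j _ = i≡j
  ... | tri> _ _ j<i = ⊥-elim (⊕-distinct u j<i i<n (sym eq))

  ⊖-distinct : ∀ u {i j} → i < j → j < n → u ⊖ i ≢ u ⊖ j
  ⊖-distinct u {i} {j} i<j j<n eq = ⊕-distinct (u ⊖ j) i<j j<n (begin
    u ⊖ j ⊕ i  ≡⟨ cong (_⊕ i) eq ⟨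
    u ⊖ i ⊕ i  ≡⟨ ⊖-⊕ u i ⟩
    u          ≡⟨ ⊖-⊕ u j ⟨
    u ⊖ j ⊕ j  ∎)

  ⊖-complement : ∀ u {c} → c ≤ n → u ⊖ (n ∸ c) ≡ u ⊕ c
  ⊖-complement u {c} c≤n = begin
    u ⊖ (n ∸ c)                 ≡⟨ cong (_⊖ (n ∸ c)) full-turn ⟨
    u ⊕ c ⊕ (n ∸ c) ⊖ (n ∸ c)   ≡⟨ ⊕-⊖ (u ⊕ c) (n ∸ c) ⟩
    u ⊕ c                       ∎
    where
      full-turn : u ⊕ c ⊕ (n ∸ c) ≡ u
      full-turn = trans (sym (⊕-+ u c (n ∸ c))) (trans (cong (u ⊕_) (m+[n∸m]≡n c≤n)) (⊕-n u))

  ⊕-permutation : ℕ → Perm.Permutation n n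
  ⊕-permutation j = Perm.permutation (_⊕ j) (_⊖ j) (λ v → ⊖-⊕ v j) (λ u → ⊕-⊖ u j)

  ∑-⊕ : ∀ j (f : Fin n → ℕ) → ∑[ u < n ] f (u ⊕ j) ≡ sum f
  ∑-⊕ j f = sym (∑-permute f (⊕-permutation j))

  ∑-⊖ : ∀ j (f : Fin n → ℕ) → ∑[ u < n ] f (u ⊖ j) ≡ sum f
  ∑-⊖ j f = sym (∑-permute f (Perm.flip (⊕-permutation j)))

  C : Graph
  C = Cycle n

  ∑-labelled-⊕ : ∀ (λ' : Labeling C) j t → ∑[ u < n ] indicator (λ' (u ⊕ j) t) ≡ edgesLabelled C λ' t
  ∑-labelled-⊕ λ' j t = ∑-⊕ j (λ e → indicator (λ' e t))

  ∑-labelled-⊖ : ∀ (λ' : Labeling C) j t → ∑[ u < n ] indicator (λ' (u ⊖ j) t) ≡ edgesLabelled C λ' t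
  ∑-labelled-⊖ λ' j t = ∑-⊖ j (λ e → indicator (λ' e t))

  Clockwise : Labeling C → Fin n → ℕ → ℕ → Set
  Clockwise λ' u = ConsecutivelyLabelled C λ' (u ⊕_)

  -- Edge i joins i and i + 1, so the j-th counterclockwise step from u uses edge u ⊖ (j + 1).
  Counterclockwise : Labeling C → Fin n → ℕ → ℕ → Set
  Counterclockwise λ' u = ConsecutivelyLabelled C λ' (λ j → u ⊖ suc j)

  module _ {λ' : Labeling C} where

    clockwiseWalk : ∀ {u s b c} → b ≤ s → Clockwise λ' u s c →
                    TWalk C λ' u (u ⊕ c) b (applyUpTo (u ⊕_) (suc c))
    clockwiseWalk {c = zero}                  _   _   = stop
    clockwiseWalk {u = u} {s} {c = suc c} b≤s run =
      step u (suc s) (labelled run 0 z<s) (s≤s b≤s) (inj₁ (refl , refl))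
        (clockwiseWalk ≤-refl (consecutive-tail C run))

    counterclockwiseWalk : ∀ {u s b c} → b ≤ s → Counterclockwise λ' u s c →
                           TWalk C λ' u (u ⊖ c) b (applyUpTo (u ⊖_) (suc c))
    counterclockwiseWalk {c = zero}                  _   _   = stop
    counterclockwiseWalk {u = u} {s} {c = suc c} b≤s run =
      step (prev u) (suc s) (labelled run 0 z<s) (s≤s b≤s) (inj₂ (next-prev u , refl))
        (counterclockwiseWalk ≤-refl (consecutive-tail C run))

    clockwisePath : ∀ {u s c} → Clockwise λ' u s c → c < n → TemporalPath C λ' u (u ⊕ c)
    clockwisePath {u} {c = c} run c<n = _ , clockwiseWalk z≤n run ,
      applyUpTo⁺₁ (u ⊕_) (suc c) (λ i<j j≤c → ⊕-distinct u i<j (<-≤-trans j≤c c<n))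

    counterclockwisePath : ∀ {u s c} → Counterclockwise λ' u s c → c < n → TemporalPath C λ' u (u ⊖ c)
    counterclockwisePath {u} {c = c} run c<n = _ , counterclockwiseWalk z≤n run ,
      applyUpTo⁺₁ (u ⊖_) (suc c) (λ i<j j≤c → ⊖-distinct u i<j (<-≤-trans j≤c c<n))

    runs⇒reaches-all : ∀ {u s s′ F B} → Clockwise λ' u s F → Counterclockwise λ' u s′ B →
                       n ≤ suc (F + B) → ∀ v → u ≡ v ⊎ TemporalPath C λ' u v
    runs⇒reaches-all {u} {F = F} {B} cw ccw n≤1+F+B v with ⊕-surjective u v
    ... | c , c<n , refl with c ≤? F
    ...   | yes c≤F = inj₂ (clockwisePath (consecutive-≤ C c≤F cw) c<n)
    ...   | no  c≰F = inj₂ (subst (TemporalPath C λ' u) (⊖-complement u (<⇒≤ c<n))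
                              (counterclockwisePath (consecutive-≤ C n∸c≤B ccw) n∸c<n))
      where
        n∸c≤B : n ∸ c ≤ B
        n∸c≤B = ≤-trans (∸-monoʳ-≤ n (≰⇒> c≰F)) (m≤n+o⇒m∸n≤o n (suc F) n≤1+F+B)
        n∸c<n : n ∸ c < n
        n∸c<n = ∸-monoʳ-< {o = 0} (≤-<-trans z≤n (≰⇒> c≰F)) (<⇒≤ c<n)

  -- The forward + backward steps of a walk need distinct labels in (b, D]; if one direction
  -- alone uses up that interval, the walk went straight that way with labels b + 1, b + 2, ….
  record Winding (λ' : Labeling C) (D b : ℕ) (u v : Fin n) : Set where
    field
      forward backward : ℕ
      fits           : forward + backward + b ≤ D
      ends           : v ⊕ backward ≡ u ⊕ forward
      tight-forward  : forward + b ≡ D → Clockwise λ' u b forward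
      tight-backward : backward + b ≡ D → Counterclockwise λ' u b backward

  module _ {λ' : Labeling C} {D : ℕ} where

    clockwiseStep : ∀ {u v b t} → λ' u t ≡ true → b < t → Winding λ' D t (next u) v → Winding λ' D b u v
    clockwiseStep {u} {v} {b} {t} label b<t w = record
      { forward        = suc f
      ; backward       = g
      ; fits           = m<n∧k+n≤o⇒1+k+m≤o (f + g) b<t fits
      ; ends           = ends
      ; tight-forward  = λ eq → uncurry (consecutive-∷ C) (advance eq)
      ; tight-backward = λ eq → ⊥-elim (m<n∧k+n≤o⇒k+m≢o g b<t g+t≤D eq)
      }
      where
        open Winding w renaming (forward to f; backward to g)
        f+t≤D : f + t ≤ D
        f+t≤D = ≤-trans (+-monoˡ-≤ t (m≤m+n f g)) fits
        g+t≤D : g + t ≤ D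
        g+t≤D = ≤-trans (+-monoˡ-≤ t (m≤n+m g f)) fits
        advance : suc f + b ≡ D → λ' u (suc b) ≡ true × Clockwise λ' (next u) (suc b) f
        advance eq = subst (λ τ → λ' u τ ≡ true × Clockwise λ' (next u) τ f) t≡1+b
                       (label , tight-forward (trans (cong (f +_) t≡1+b) (trans (+-suc f b) eq)))
          where
            t≡1+b : t ≡ suc b
            t≡1+b = m<n∧k+n≤o∧1+k+m≡o⇒n≡1+m f b<t f+t≤D eq

    counterclockwiseStep : ∀ {e v b t} → λ' e t ≡ true → b < t → Winding λ' D t e v → Winding λ' D b (next e) v
    counterclockwiseStep {e} {v} {b} {t} label b<t w = record
      { forward        = f
      ; backward       = suc g
      ; fits           = subst (λ x → x + b ≤ D) (sym (+-suc f g)) (m<n∧k+n≤o⇒1+k+m≤o (f + g) b<t fits)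
      ; ends           = begin
          v ⊕ suc g       ≡⟨ ⊕-suc v g ⟩
          next (v ⊕ g)    ≡⟨ cong next ends ⟩
          next (e ⊕ f)    ≡⟨ ⊕-suc e f ⟨
          next e ⊕ f      ∎
      ; tight-forward  = λ eq → ⊥-elim (m<n∧k+n≤o⇒k+m≢o f b<t f+t≤D eq)
      ; tight-backward = λ eq → uncurry (consecutive-∷ C) (advance eq)
      }
      where
        open Winding w renaming (forward to f; backward to g)
        f+t≤D : f + t ≤ D
        f+t≤D = ≤-trans (+-monoˡ-≤ t (m≤m+n f g)) fits
        g+t≤D : g + t ≤ D
        g+t≤D = ≤-trans (+-monoˡ-≤ t (m≤n+m g f)) fits
        advance : suc g + b ≡ D →
                  λ' (prev (next e)) (suc b) ≡ true × Counterclockwise λ' (prev (next e)) (suc b) g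
        advance eq = subst (λ x → λ' x (suc b) ≡ true × Counterclockwise λ' x (suc b) g) (sym (prev-next e))
                       (subst (λ τ → λ' e τ ≡ true × Counterclockwise λ' e τ g) t≡1+b
                         (label , tight-backward (trans (cong (g +_) t≡1+b) (trans (+-suc g b) eq))))
          where
            t≡1+b : t ≡ suc b
            t≡1+b = m<n∧k+n≤o∧1+k+m≡o⇒n≡1+m g b<t g+t≤D eq

    winding : LabelsWithinAge C λ' D → ∀ {u v b vs} → b ≤ D → TWalk C λ' u v b vs → Winding λ' D b u v
    winding within b≤D stop = record
      { forward = 0 ; backward = 0 ; fits = b≤D ; ends = refl
      ; tight-forward = λ _ → consecutive λ _ () ; tight-backward = λ _ → consecutive λ _ () }
    winding within _ (step e t label b<t (inj₁ (refl , refl)) rest) =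
      clockwiseStep label b<t (winding within (proj₂ (within e t label)) rest)
    winding within _ (step e t label b<t (inj₂ (refl , refl)) rest) =
      counterclockwiseStep label b<t (winding within (proj₂ (within e t label)) rest)

  module _ {λ' : Labeling C} {d : ℕ} where

    straight-from-winding : 0 < d → d + d ≤ n → ∀ {u} → Winding λ' d 0 u (u ⊕ d) →
                            Clockwise λ' u 0 d ⊎ (d + d ≡ n × Counterclockwise λ' u 0 d)
    straight-from-winding 0<d 2d≤n {u} w with d + Winding.backward w <? n
    ... | yes d+g<n = inj₁ (subst (Clockwise λ' u 0) f≡d (tight-forward (trans (+-identityʳ f) f≡d)))
      where
        open Winding w renaming (forward to f; backward to g)
        f≤d : f ≤ d
        f≤d = m+n≤o⇒m≤o f (subst (_≤ d) (+-identityʳ (f + g)) fits)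
        d+g≡f : d + g ≡ f
        d+g≡f = ⊕-injective u d+g<n (≤-<-trans f≤d (<-≤-trans (m<m+n d 0<d) 2d≤n)) (trans (⊕-+ u d g) ends)
        f≡d : f ≡ d
        f≡d = ≤-antisym f≤d (subst (d ≤_) d+g≡f (m≤m+n d g))
    ... | no  d+g≮n =
      inj₂ (2d≡n , subst (Counterclockwise λ' u 0) g≡d (tight-backward (trans (+-identityʳ g) g≡d)))
      where
        open Winding w renaming (forward to f; backward to g)
        n≤d+g : n ≤ d + g
        n≤d+g = ≮⇒≥ d+g≮n
        g≡d : g ≡ d
        g≡d = ≤-antisym (m+n≤o⇒n≤o f (subst (_≤ d) (+-identityʳ (f + g)) fits))
                        (+-cancelˡ-≤ d d g (≤-trans 2d≤n n≤d+g))
        2d≡n : d + d ≡ n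
        2d≡n = ≤-antisym 2d≤n (subst (λ x → n ≤ d + x) g≡d n≤d+g)

  module _ {λ' : Labeling C} {d : ℕ} (within : LabelsWithinAge C λ' d) (connected : TemporallyConnected C λ') where

    straight-to-antipode : 0 < d → d + d ≤ n →
                           ∀ u → Clockwise λ' u 0 d ⊎ (d + d ≡ n × Counterclockwise λ' u 0 d)
    straight-to-antipode 0<d 2d≤n u with connected u (u ⊕ d)
    ... | inj₁ u≡u⊕d          = ⊥-elim (⊕-fixpoint-free u 0<d (<-≤-trans (m<m+n d 0<d) 2d≤n) (sym u≡u⊕d))
    ... | inj₂ (_ , walk , _) = straight-from-winding 0<d 2d≤n (winding within z≤n walk)

    odd-lower-bound : n ≡ suc (d + d) → d * n ≤ labelSize C λ' d
    odd-lower-bound n≡1+2d = labelSize-≥ C λ' d n slot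
      where
        clockwise : 0 < d → ∀ u → Clockwise λ' u 0 d
        clockwise 0<d u with straight-to-antipode 0<d (subst (d + d ≤_) (sym n≡1+2d) (n≤1+n (d + d))) u
        ... | inj₁ cw            = cw
        ... | inj₂ (2d≡n , _)    = ⊥-elim (1+n≢n (trans (sym n≡1+2d) (sym 2d≡n)))
        slot : ∀ j → j < d → n ≤ edgesLabelled C λ' (suc j)
        slot j j<d = subst (n ≤_) (∑-labelled-⊕ λ' j (suc j)) (∑-positive λ u →
          1≤indicator (labelled₀ C (clockwise (≤-<-trans z≤n j<d) u) j j<d))

    even-lower-bound : n ≡ d + d → d * d ≤ labelSize C λ' d
    even-lower-bound n≡2d = labelSize-≥ C λ' d d slot
      where
        slot : ∀ j → j < d → d ≤ edgesLabelled C λ' (suc j)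
        slot j j<d = m+m≤n+n⇒m≤n (subst₂ _≤_ n≡2d sides (∑-positive covered))
          where
            A B : Fin n → ℕ
            A u = indicator (λ' (u ⊕ j) (suc j))
            B u = indicator (λ' (u ⊖ suc j) (suc j))
            sides : ∑[ u < n ] (A u + B u) ≡ edgesLabelled C λ' (suc j) + edgesLabelled C λ' (suc j)
            sides = trans (∑-distrib-+ A B) (cong₂ _+_ (∑-labelled-⊕ λ' j (suc j)) (∑-labelled-⊖ λ' (suc j) (suc j)))
            covered : ∀ u → 1 ≤ A u + B u
            covered u with straight-to-antipode (≤-<-trans z≤n j<d) (≤-reflexive (sym n≡2d)) u
            ... | inj₁ cw        = ≤-trans (1≤indicator (labelled₀ C cw j j<d)) (m≤m+n (A u) (B u))
            ... | inj₂ (_ , ccw) = ≤-trans (1≤indicator (labelled₀ C ccw j j<d)) (m≤n+m (B u) (A u))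

  parity-⊕ : parity n ≡ 0ℙ → ∀ u j → parity (toℕ (u ⊕ j)) ≡ parity (toℕ u) ℙ.+ parity j
  parity-⊕ pn u j = trans (cong parity (toℕ-⊕ u j)) (trans (parity-% (toℕ u + j) n pn) (+-homo-+ (toℕ u) j))

  parity-⊖ : parity n ≡ 0ℙ → ∀ u j → parity (toℕ (u ⊖ j)) ≡ parity (toℕ u) ℙ.+ parity j
  parity-⊖ pn u j = begin
    parity (toℕ (u ⊖ j))                         ≡⟨ p+q+q≡p (parity (toℕ (u ⊖ j))) (parity j) ⟨
    parity (toℕ (u ⊖ j)) ℙ.+ parity j ℙ.+ parity j ≡⟨ cong (ℙ._+ parity j) (parity-⊕ pn (u ⊖ j) j) ⟨
    parity (toℕ (u ⊖ j ⊕ j)) ℙ.+ parity j          ≡⟨ cong (λ x → parity (toℕ x) ℙ.+ parity j) (⊖-⊕ u j) ⟩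
    parity (toℕ u) ℙ.+ parity j                    ∎

  oddLabeling : ℕ → Labeling C
  oddLabeling d e t = does (window? d t)

  evenLabeling : ℕ → Labeling C
  evenLabeling d e t = does (window? d t ×-dec parity (toℕ e + t) ℙₚ.≟ 1ℙ)

  oddLabeling-within : ∀ d → LabelsWithinAge C (oddLabeling d) d
  oddLabeling-within d e t = fromDoes (window? d t)

  evenLabeling-within : ∀ d → LabelsWithinAge C (evenLabeling d) d
  evenLabeling-within d e t labelled = proj₁ (fromDoes (window? d t ×-dec parity (toℕ e + t) ℙₚ.≟ 1ℙ) labelled)

  evenLabeling-true : ∀ {d} e {t} → InWindow d t → parity (toℕ e + t) ≡ 1ℙ → evenLabeling d e t ≡ true
  evenLabeling-true {d} e {t} w odd = dec-true (window? d t ×-dec parity (toℕ e + t) ℙₚ.≟ 1ℙ) (w , odd)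

  oddLabeling-consecutive : ∀ d {es} → ConsecutivelyLabelled C (oddLabeling d) es 0 d
  oddLabeling-consecutive d = consecutive λ j j<d → dec-true (window? d _) (inWindow (≤-reflexive (+-identityʳ d)) j<d)

  oddLabeling-connected : ∀ d → n ≡ suc (d + d) → TemporallyConnected C (oddLabeling d)
  oddLabeling-connected d n≡1+2d u =
    runs⇒reaches-all (oddLabeling-consecutive d) (oddLabeling-consecutive d) (≤-reflexive n≡1+2d)

  oddLabeling-size : ∀ d → labelSize C (oddLabeling d) d ≡ d * n
  oddLabeling-size d = labelSize-≡ C (oddLabeling d) d n λ j j<d → begin
    ∑[ e < n ] indicator (does (window? d (suc j))) ≡⟨ cong (λ b → ∑[ e < n ] indicator b) (window?-true j<d) ⟩
    ∑[ e < n ] 1                                    ≡⟨ ∑-const n 1 ⟩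
    n * 1                                           ≡⟨ *-identityʳ n ⟩
    n                                               ∎

  module _ {d : ℕ} (n≡2d : n ≡ d + d) where

    parity-n : parity n ≡ 0ℙ
    parity-n = trans (cong parity n≡2d) (trans (+-homo-+ d d) (ℙₚ.p+p≡0ℙ (parity d)))

    parity-clockwise : ∀ u s j → parity (toℕ (u ⊕ j) + suc (j + s)) ≡ parity (toℕ u) ℙ.+ parity (suc s)
    parity-clockwise u s j = begin
      parity (toℕ (u ⊕ j) + suc (j + s))
        ≡⟨ +-homo-+ (toℕ (u ⊕ j)) (suc (j + s)) ⟩
      parity (toℕ (u ⊕ j)) ℙ.+ parity (suc (j + s))
        ≡⟨ cong₂ ℙ._+_ (parity-⊕ parity-n u j) (trans (cong parity (sym (+-suc j s))) (+-homo-+ j (suc s))) ⟩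
      (parity (toℕ u) ℙ.+ parity j) ℙ.+ (parity j ℙ.+ parity (suc s))
        ≡⟨ [p+q]+[q+r]≡p+r (parity (toℕ u)) (parity j) (parity (suc s)) ⟩
      parity (toℕ u) ℙ.+ parity (suc s) ∎

    parity-counterclockwise : ∀ u s j → parity (toℕ (u ⊖ suc j) + suc (j + s)) ≡ parity (toℕ u) ℙ.+ parity s
    parity-counterclockwise u s j = begin
      parity (toℕ (u ⊖ suc j) + (suc j + s))
        ≡⟨ +-homo-+ (toℕ (u ⊖ suc j)) (suc j + s) ⟩
      parity (toℕ (u ⊖ suc j)) ℙ.+ parity (suc j + s)
        ≡⟨ cong₂ ℙ._+_ (parity-⊖ parity-n u (suc j)) (+-homo-+ (suc j) s) ⟩
      (parity (toℕ u) ℙ.+ parity (suc j)) ℙ.+ (parity (suc j) ℙ.+ parity s)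
        ≡⟨ [p+q]+[q+r]≡p+r (parity (toℕ u)) (parity (suc j)) (parity s) ⟩
      parity (toℕ u) ℙ.+ parity s ∎

    evenLabeling-clockwise : ∀ u {s c} → parity (toℕ u) ℙ.+ parity (suc s) ≡ 1ℙ → c + s ≤ d →
                             Clockwise (evenLabeling d) u s c
    evenLabeling-clockwise u {s} odd c+s≤d = consecutive λ j j<c →
      evenLabeling-true (u ⊕ j) (inWindow c+s≤d j<c) (trans (parity-clockwise u s j) odd)

    evenLabeling-counterclockwise : ∀ u {s c} → parity (toℕ u) ℙ.+ parity s ≡ 1ℙ → c + s ≤ d →
                                    Counterclockwise (evenLabeling d) u s c
    evenLabeling-counterclockwise u {s} odd c+s≤d = consecutive λ j j<c →
      evenLabeling-true (u ⊖ suc j) (inWindow c+s≤d j<c) (trans (parity-counterclockwise u s j) odd)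

    evenLabeling-size : labelSize C (evenLabeling d) d ≡ d * d
    evenLabeling-size = labelSize-≡ C (evenLabeling d) d d λ j j<d → begin
      ∑[ e < n ] indicator (does (window? d (suc j)) ∧ isOdd (toℕ e + suc j))
        ≡⟨ sum-cong-≗ {n} (λ e → cong (λ b → indicator (b ∧ isOdd (toℕ e + suc j))) (window?-true j<d)) ⟩
      ∑[ e < n ] indicator (isOdd (toℕ e + suc j))
        ≡⟨ subst (λ N → ∑[ e < N ] indicator (isOdd (toℕ e + suc j)) ≡ d) (sym n≡2d) (∑-isOdd d (suc j)) ⟩
      d ∎

  evenLabeling-connected : ∀ d → n ≡ d + d → TemporallyConnected C (evenLabeling d)
  evenLabeling-connected zero    ()
  evenLabeling-connected (suc d) n≡2d u = byParity (parity (toℕ u)) refl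
    where
      whole : suc d + 0 ≤ suc d
      whole = ≤-reflexive (+-identityʳ (suc d))
      late : d + 1 ≤ suc d
      late = ≤-reflexive (+-comm d 1)
      byParity : ∀ p → parity (toℕ u) ≡ p → ∀ v → u ≡ v ⊎ TemporalPath C (evenLabeling (suc d)) u v
      byParity 0ℙ pu = runs⇒reaches-all
        (evenLabeling-clockwise        n≡2d u {0} {suc d} (cong (ℙ._+ 1ℙ) pu) whole)
        (evenLabeling-counterclockwise n≡2d u {1} {d}     (cong (ℙ._+ 1ℙ) pu) late)
        (≤-reflexive (trans n≡2d (cong suc (+-suc d d))))
      byParity 1ℙ pu = runs⇒reaches-all
        (evenLabeling-clockwise        n≡2d u {1} {d}     (cong (ℙ._+ 0ℙ) pu) late)
        (evenLabeling-counterclockwise n≡2d u {0} {suc d} (cong (ℙ._+ 0ℙ) pu) whole)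
        (≤-reflexive n≡2d)

  κ-odd-cycle : ∀ d → n ≡ suc (d + d) → KappaIs C d (d * n)
  κ-odd-cycle d n≡1+2d =
    (oddLabeling d , oddLabeling-within d , oddLabeling-connected d n≡1+2d , oddLabeling-size d) ,
    λ _ within connected → odd-lower-bound within connected n≡1+2d

  κ-even-cycle : ∀ d → n ≡ d + d → KappaIs C d (d * d)
  κ-even-cycle d n≡2d =
    (evenLabeling d , evenLabeling-within d , evenLabeling-connected d n≡2d , evenLabeling-size {d} n≡2d) ,
    λ _ within connected → even-lower-bound within connected n≡2d

lemma4 : ∀ (n : ℕ) → 3 ≤ n → n ≢ 4 →
    (n ≡ 2 * ⌊ n /2⌋ → KappaIs (Cycle n) ⌊ n /2⌋ (⌊ n /2⌋ * ⌊ n /2⌋))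
    × (n ≡ 2 * ⌊ n /2⌋ + 1 →
        KappaIs (Cycle n) ⌊ n /2⌋ (2 * (⌊ n /2⌋ * ⌊ n /2⌋) + ⌊ n /2⌋))
lemma4 zero    () _
lemma4 (suc k) _  _ =
  (λ n≡2d → κ-even-cycle d (trans n≡2d (cong (d +_) (+-identityʳ d)))) ,
  (λ n≡2d+1 → subst (KappaIs (Cycle (suc k)) d)
                    (trans (cong (d *_) n≡2d+1) (m*[2m+1]≡2[m*m]+m d))
                    (κ-odd-cycle d (trans n≡2d+1 (2m+1≡1+m+m d))))
  where
    open OnCycle k
    d : ℕ
    d = ⌊ suc k /2⌋
    m*[2m+1]≡2[m*m]+m : ∀ m → m * (2 * m + 1) ≡ 2 * (m * m) + m
    m*[2m+1]≡2[m*m]+m = solve-∀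
    2m+1≡1+m+m : ∀ m → 2 * m + 1 ≡ suc (m + m)
    2m+1≡1+m+m = solve-∀
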